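{- Define integers $d_2 = 4$ and $d_j = j^{d_{j-1}/(j-1)}$ for $j \ge 3$. Then for every $j \ge 5$ we have $d_{j+1} > d_j^{\,d_{j-1}}$. -}

module Defs where

open import Data.Nat using (ℕ; zero; suc; _^_; _/_)

-- d 2 = 4, d j = j ^ (d (j-1) / (j-1)) for j ≥ 3.
-- Values at 0 and 1 are junk (unused). The division is exact (d (j-1) is a
-- positive power of j-1), so ℕ floor division agrees with the paper.
d : ℕ → ℕ
d zero = 0
d (suc zero) = 0
d (suc (suc zero)) = 4
d (suc (suc (suc n))) = suc (suc (suc n)) ^ (d (suc (suc n)) / suc (suc n))

{-# OPTIONS --safe #-}
-- Write d (j - 1) = a ^ x with a = j - 1 and x ≥ 2.  The recursion then gives
-- d j = (a + 1) ^ a ^ (x - 1) and d (j + 1) = (a + 2) ^ (a + 1) ^ (a ^ (x - 1) - 1),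
-- so d j ^ d (j - 1) = (a + 1) ^ a ^ (2x - 1).  Comparing exponents reduces the claim
-- to 2x - 1 ≤ a ^ (x - 1) - 1, which Bernoulli's inequality gives for a ≥ 4; the
-- larger base a + 2 makes the inequality strict.
module Submission where

open import Data.Nat using (ℕ; zero; suc; _^_; _≤_; _<_; _∸_; _+_; _*_; _/_; z≤n; s≤s; NonZero)
open import Data.Nat.Properties
open import Data.Nat.DivMod using (/-congˡ; m*n/n≡m)
open import Relation.Binary.PropositionalEquality using (_≡_; sym; trans; cong)
open import Defs using (d)

^-/-base : ∀ m {n} .{{_ : NonZero m}} → 1 ≤ n → m ^ n / m ≡ m ^ (n ∸ 1)
^-/-base m {suc n} _ = trans (/-congˡ (*-comm m (m ^ n))) (m*n/n≡m (m ^ n) m)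

bernoulli : ∀ m n → 1 + n * m ≤ suc m ^ n
bernoulli m zero    = ≤-refl
bernoulli m (suc n) = begin
  1 + (m + n * m)            ≡⟨ sym (+-suc m (n * m)) ⟩
  m + (1 + n * m)            ≤⟨ +-mono-≤ (m≤m*n m (suc m ^ n) {{m^n≢0 (suc m) n}}) (bernoulli m n) ⟩
  m * suc m ^ n + suc m ^ n  ≡⟨ +-comm (m * suc m ^ n) (suc m ^ n) ⟩
  suc m ^ suc n              ∎
  where open ≤-Reasoning

n+1+n<m^n : ∀ {m n} → 4 ≤ m → 1 ≤ n → n + suc n < m ^ n
n+1+n<m^n {suc m} {n} (s≤s 3≤m) 1≤n = begin-strict
  n + suc n        ≤⟨ +-monoʳ-≤ n (+-monoˡ-≤ n 1≤n) ⟩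
  n + (n + n)      ≡⟨ cong (λ k → n + (n + k)) (sym (+-identityʳ n)) ⟩
  3 * n            ≤⟨ *-monoˡ-≤ n 3≤m ⟩
  m * n            ≡⟨ *-comm m n ⟩
  n * m            <⟨ n<1+n (n * m) ⟩
  1 + n * m        ≤⟨ bernoulli m n ⟩
  suc m ^ n        ∎
  where open ≤-Reasoning

tower-< : ∀ a x → 4 ≤ a → 2 ≤ x →
  (suc a ^ a ^ (x ∸ 1)) ^ a ^ x < suc (suc a) ^ suc a ^ (a ^ (x ∸ 1) ∸ 1)
tower-< a (suc p) 4≤a (s≤s 1≤p) = begin-strict
  (suc a ^ a ^ p) ^ a ^ suc p  ≡⟨ ^-*-assoc (suc a) (a ^ p) (a ^ suc p) ⟩
  suc a ^ (a ^ p * a ^ suc p)  ≡⟨ cong (suc a ^_) (sym (^-distribˡ-+-* a p (suc p))) ⟩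
  suc a ^ a ^ (p + suc p)      ≤⟨ ^-monoʳ-≤ (suc a) (^-monoˡ-≤ (p + suc p) (n≤1+n a)) ⟩
  suc a ^ suc a ^ (p + suc p)  ≤⟨ ^-monoʳ-≤ (suc a) (^-monoʳ-≤ (suc a) p+1+p≤k) ⟩
  suc a ^ suc a ^ k            <⟨ ^-monoˡ-< (suc a ^ k) {{m^n≢0 (suc a) k}} (n<1+n (suc a)) ⟩
  suc (suc a) ^ suc a ^ k      ∎
  where
  open ≤-Reasoning
  k : ℕ
  k = a ^ p ∸ 1
  p+1+p≤k : p + suc p ≤ k
  p+1+p≤k = ∸-monoˡ-≤ 1 (n+1+n<m^n 4≤a 1≤p)

-- d (3 + n) ≡ (3 + n) ^ exponent n holds definitionally.
exponent : ℕ → ℕ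
exponent n = d (2 + n) / (2 + n)

2≤exponent : ∀ n → 2 ≤ exponent n
2≤exponent zero    = ≤-refl
2≤exponent (suc n) = begin
  2                          ≤⟨ s≤s (s≤s z≤n) ⟩
  3 + n                      ≡⟨ sym (^-identityʳ (3 + n)) ⟩
  (3 + n) ^ 1                ≤⟨ ^-monoʳ-≤ (3 + n) (∸-monoˡ-≤ 1 (2≤exponent n)) ⟩
  (3 + n) ^ (exponent n ∸ 1) ≡⟨ sym (^-/-base (3 + n) (<⇒≤ (2≤exponent n))) ⟩
  exponent (suc n)           ∎
  where open ≤-Reasoning

exponent-suc : ∀ n → exponent (suc n) ≡ (3 + n) ^ (exponent n ∸ 1)
exponent-suc n = ^-/-base (3 + n) (<⇒≤ (2≤exponent n))

lemma7 : (j : ℕ) → 5 ≤ j → d j ^ d (j ∸ 1) < d (suc j)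
lemma7 .(5 + m) (s≤s (s≤s (s≤s (s≤s (s≤s {n = m} _))))) = begin-strict
  d (5 + m) ^ d (4 + m)
    ≡⟨ cong (λ y → ((5 + m) ^ y) ^ d (4 + m)) (exponent-suc (1 + m)) ⟩
  ((5 + m) ^ (4 + m) ^ (x ∸ 1)) ^ (4 + m) ^ x
    <⟨ tower-< (4 + m) x (s≤s (s≤s (s≤s (s≤s z≤n)))) (2≤exponent (1 + m)) ⟩
  (6 + m) ^ (5 + m) ^ ((4 + m) ^ (x ∸ 1) ∸ 1)
    ≡⟨ cong (λ y → (6 + m) ^ (5 + m) ^ (y ∸ 1)) (sym (exponent-suc (1 + m))) ⟩
  (6 + m) ^ (5 + m) ^ (exponent (2 + m) ∸ 1)
    ≡⟨ cong ((6 + m) ^_) (sym (exponent-suc (2 + m))) ⟩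
  d (6 + m) ∎
  where
  open ≤-Reasoning
  x : ℕ
  x = exponent (1 + m)
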